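{- Let $k\ge 1$ be an integer and let $G$ be a simple graph on $n$ vertices ($n$ even). (1) If $G$ is $(2k+1)$-regular and has a bisection of size at most $n/2+k(k+1)-1$, then $G$ has an internal partition. (2) If $G$ is $2k$-regular and has a bisection of size at most $n+k(k-1)-1$, then $G$ has an internal partition.
   Context: A bisection of a graph on $n$ vertices is a partition of its vertex set into two sets of equal size; its size is the number of edges joining the two sets. An internal partition of a graph is a partition of the vertex set into two nonempty sets such that every vertex has at least as many neighbours in its own class as in the other class. -}

module Defs where

open import Data.Nat using (ℕ; zero; suc; _+_; _*_; _∸_; _≤_; _<ᵇ_)
open import Data.Fin using (Fin; toℕ)
open import Data.Bool using (Bool; true; false; if_then_else_; _∧_; _xor_; not)
open import Data.List using (List; map; allFin)
open import Data.Nat.ListAction using (sum)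
open import Data.Product using (Σ; _×_; ∃)
open import Relation.Binary.PropositionalEquality using (_≡_)

count : {n : ℕ} → (Fin n → Bool) → ℕ
count {n} p = sum (map (λ i → if p i then 1 else 0) (allFin n))

record SimpleGraph (n : ℕ) : Set where
  field
    adj      : Fin n → Fin n → Bool
    symmetric : ∀ i j → adj i j ≡ adj j i
    irreflexive : ∀ i → adj i i ≡ false
open SimpleGraph public

degree : {n : ℕ} → SimpleGraph n → Fin n → ℕ
degree G v = count (adj G v)

Regular : {n : ℕ} → ℕ → SimpleGraph n → Set
Regular d G = ∀ v → degree G v ≡ d

Partition : ℕ → Set
Partition n = Fin n → Bool

cutSize : {n : ℕ} → SimpleGraph n → Partition n → ℕ
cutSize G P = sum (map (λ i → count (λ j → (toℕ i <ᵇ toℕ j) ∧ adj G i j ∧ (P i xor P j))) (allFin _))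

IsBisection : {n : ℕ} → Partition n → Set
IsBisection {n} P = 2 * count P ≡ n

HasBisectionOfSizeAtMost : {n : ℕ} → SimpleGraph n → ℕ → Set
HasBisectionOfSizeAtMost G b = ∃ λ P → IsBisection P × cutSize G P ≤ b

-- neighbours of v lying in class c
nbrsIn : {n : ℕ} → SimpleGraph n → Partition n → Bool → Fin n → ℕ
nbrsIn G P c v = count (λ u → adj G v u ∧ (if P u then c else not c))

IsInternalPartition : {n : ℕ} → SimpleGraph n → Partition n → Set
IsInternalPartition G P =
  (∃ λ u → P u ≡ true) × (∃ λ u → P u ≡ false) ×
  (∀ v → nbrsIn G P (not (P v)) v ≤ nbrsIn G P (P v) v)

HasInternalPartition : {n : ℕ} → SimpleGraph n → Set
HasInternalPartition G = ∃ λ P → IsInternalPartition G P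

-- Local search from a bisection with classes of size m and cut at most C.  While some vertex has
-- more neighbours in the other class than in its own, move it across.  In a d-regular graph such
-- a move lowers the cut by at least γ = 1, and by γ = 2 when d is even (own + other = d forces the
-- difference to be even), while each class size changes by one; so the potential
-- cut + γ (m − |class|) never exceeds C, and the process terminates.  A class of a vertices sends
-- at least a (d + 1 − a) edges across, which together with the potential bound rules out a = t
-- (t = k + 1 for odd d, t = k for even d).  Class sizes start at m ≥ t and move in steps of one,
-- so both classes stay larger than t: the final partition is internal.

module Submission where

open import Data.Nat.Properties hiding (_≟_)
open import Algebra.Properties.Semiring.Sum +-*-semiring
  using (sum-syntax; sum-cong-≗; ∑-distrib-+; ∑-comm; sum-replicate-zero; *-distribˡ-sum; *-distribʳ-sum)
open import Data.Bool using (Bool; true; false; if_then_else_; _∧_; _xor_; not)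
open import Data.Bool.Properties using (not-injective; not-involutive; xor-comm; not-distribˡ-xor; not-distribʳ-xor)
open import Data.Fin using (Fin; toℕ; zero; suc)
open import Data.Fin.Properties using (_≟_; toℕ-injective; all?; ¬∀⟶∃¬)
open import Data.List using (map; allFin; tabulate)
open import Data.List.Properties using (map-tabulate)
import Data.Nat.ListAction as List
open import Data.Nat using (ℕ; zero; suc; _+_; _*_; _∸_; _≤_; _<_; _<ᵇ_; _≤?_; z≤n)
open import Data.Nat.Induction using (<-wellFounded)
open import Data.Nat.Tactic.RingSolver using (solve-∀)
open import Data.Product using (∃; _×_; _,_)
open import Data.Sum using (inj₁; inj₂)
open import Data.Vec.Functional using (updateAt)
open import Data.Vec.Functional.Properties using (updateAt-updates; updateAt-minimal)
open import Function using (_∘_; id)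
open import Induction.WellFounded using (Acc; acc)
open import Relation.Binary.PropositionalEquality
open import Relation.Nullary using (yes; no; does; ofʸ; ofⁿ; contradiction)

open import Defs

𝟙 : Bool → ℕ
𝟙 b = if b then 1 else 0

δ : ∀ {n} → Fin n → Fin n → ℕ
δ w j = 𝟙 (does (j ≟ w))

[_≺_] : ∀ {n} → Fin n → Fin n → ℕ
[ i ≺ j ] = 𝟙 (toℕ i <ᵇ toℕ j)

𝟙≤1 : ∀ b → 𝟙 b ≤ 1
𝟙≤1 false = z≤n
𝟙≤1 true = ≤-refl

𝟙-∧ : ∀ a b → 𝟙 (a ∧ b) ≡ 𝟙 a * 𝟙 b
𝟙-∧ false b = refl
𝟙-∧ true b = sym (+-identityʳ (𝟙 b))

𝟙-∧-split : ∀ a b → 𝟙 (a ∧ not b) + 𝟙 (a ∧ b) ≡ 𝟙 a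
𝟙-∧-split false b = refl
𝟙-∧-split true false = refl
𝟙-∧-split true true = refl

𝟙-∧-exchange : ∀ a b → 𝟙 (a ∧ not b) + 1 * 𝟙 (a ∧ b) ≡ 𝟙 (a ∧ b) + 1 * 𝟙 (a ∧ not b)
𝟙-∧-exchange false b = refl
𝟙-∧-exchange true false = refl
𝟙-∧-exchange true true = refl

𝟙-partition : ∀ b x → 𝟙 b * x + 𝟙 (not b) * x ≡ x
𝟙-partition false x = +-identityʳ x
𝟙-partition true x = trans (+-identityʳ (x + 0)) (+-identityʳ x)

𝟙*-mono-≤ : ∀ b {x y} → (b ≡ true → x ≤ y) → 𝟙 b * x ≤ 𝟙 b * y
𝟙*-mono-≤ false x≤y = z≤n
𝟙*-mono-≤ true x≤y = *-monoʳ-≤ 1 (x≤y refl)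

∑-mono-≤ : ∀ {n} {f g : Fin n → ℕ} → (∀ i → f i ≤ g i) → ∑[ i < n ] f i ≤ ∑[ i < n ] g i
∑-mono-≤ {zero} f≤g = z≤n
∑-mono-≤ {suc n} f≤g = +-mono-≤ (f≤g zero) (∑-mono-≤ (f≤g ∘ suc))

∑-const : ∀ n c → ∑[ i < n ] c ≡ n * c
∑-const zero c = refl
∑-const (suc n) c = cong (c +_) (∑-const n c)

∑-δ* : ∀ {n} (w : Fin n) (f : Fin n → ℕ) → ∑[ j < n ] (δ w j * f j) ≡ f w
∑-δ* {suc n} zero f = trans (cong₂ _+_ (+-identityʳ (f zero)) (sum-replicate-zero n)) (+-identityʳ (f zero))
∑-δ* {suc n} (suc w) f = ∑-δ* w (f ∘ suc)

∑-+δ : ∀ {n} (w : Fin n) (f : Fin n → ℕ) → ∑[ j < n ] (f j + δ w j) ≡ suc (∑[ j < n ] f j)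
∑-+δ {n} w f = begin
  ∑[ j < n ] (f j + δ w j)            ≡⟨ ∑-distrib-+ f (δ w) ⟩
  ∑[ j < n ] f j + ∑[ j < n ] δ w j   ≡⟨ cong (∑[ j < n ] f j +_) ∑δ≡1 ⟩
  ∑[ j < n ] f j + 1                  ≡⟨ +-comm _ 1 ⟩
  suc (∑[ j < n ] f j)                ∎
  where
  open ≡-Reasoning
  ∑δ≡1 : ∑[ j < n ] δ w j ≡ 1
  ∑δ≡1 = trans (sum-cong-≗ λ j → sym (*-identityʳ (δ w j))) (∑-δ* w (λ _ → 1))

∑∑-distrib-+ : ∀ {n} (f g : Fin n → Fin n → ℕ) →
  ∑[ i < n ] (∑[ j < n ] (f i j + g i j)) ≡ ∑[ i < n ] (∑[ j < n ] f i j) + ∑[ i < n ] (∑[ j < n ] g i j)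
∑∑-distrib-+ {n} f g =
  trans (sum-cong-≗ λ i → ∑-distrib-+ (f i) (g i)) (∑-distrib-+ (λ i → ∑[ j < n ] f i j) _)

module _ {n : ℕ} (f : Fin n → Fin n → ℕ) (f-sym : ∀ i j → f i j ≡ f j i) where

  ∑∑-δ-pair : ∀ w →
    ∑[ i < n ] (∑[ j < n ] ((δ w i + δ w j) * f i j)) ≡ ∑[ j < n ] f w j + ∑[ j < n ] f w j
  ∑∑-δ-pair w = begin
    ∑[ i < n ] (∑[ j < n ] ((δ w i + δ w j) * f i j))
      ≡⟨ sum-cong-≗ (λ i → sum-cong-≗ λ j → *-distribʳ-+ (f i j) (δ w i) (δ w j)) ⟩
    ∑[ i < n ] (∑[ j < n ] (δ w i * f i j + δ w j * f i j))
      ≡⟨ ∑∑-distrib-+ (λ i j → δ w i * f i j) (λ i j → δ w j * f i j) ⟩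
    ∑[ i < n ] (∑[ j < n ] (δ w i * f i j)) + ∑[ i < n ] (∑[ j < n ] (δ w j * f i j))
      ≡⟨ cong₂ _+_ row column ⟩
    ∑[ j < n ] f w j + ∑[ j < n ] f w j ∎
    where
    open ≡-Reasoning
    row : ∑[ i < n ] (∑[ j < n ] (δ w i * f i j)) ≡ ∑[ j < n ] f w j
    row = trans (sum-cong-≗ λ i → sym (*-distribˡ-sum (δ w i) (f i))) (∑-δ* w (λ i → ∑[ j < n ] f i j))
    column : ∑[ i < n ] (∑[ j < n ] (δ w j * f i j)) ≡ ∑[ j < n ] f w j
    column = sum-cong-≗ λ i → trans (∑-δ* w (f i)) (f-sym i w)

  module _ (f-diag : ∀ i → f i i ≡ 0) where

    split-by-order : ∀ i j → f i j ≡ [ i ≺ j ] * f i j + [ j ≺ i ] * f i j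
    split-by-order i j
      with toℕ i <ᵇ toℕ j | <ᵇ-reflects-< (toℕ i) (toℕ j)
         | toℕ j <ᵇ toℕ i | <ᵇ-reflects-< (toℕ j) (toℕ i)
    ... | true  | ofʸ i<j | true  | ofʸ j<i = contradiction j<i (<-asym i<j)
    ... | true  | _       | false | _       = sym (trans (+-identityʳ _) (+-identityʳ _))
    ... | false | _       | true  | _       = sym (+-identityʳ _)
    ... | false | ofⁿ i≮j | false | ofⁿ j≮i with toℕ-injective (≤-antisym (≮⇒≥ j≮i) (≮⇒≥ i≮j))
    ...   | refl = f-diag i

    ∑∑-symmetric : ∑[ i < n ] (∑[ j < n ] f i j) ≡ 2 * ∑[ i < n ] (∑[ j < n ] ([ i ≺ j ] * f i j))
    ∑∑-symmetric = begin
      ∑[ i < n ] (∑[ j < n ] f i j)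
        ≡⟨ sum-cong-≗ (λ i → sum-cong-≗ (split-by-order i)) ⟩
      ∑[ i < n ] (∑[ j < n ] ([ i ≺ j ] * f i j + [ j ≺ i ] * f i j))
        ≡⟨ ∑∑-distrib-+ (λ i j → [ i ≺ j ] * f i j) (λ i j → [ j ≺ i ] * f i j) ⟩
      U + ∑[ i < n ] (∑[ j < n ] ([ j ≺ i ] * f i j))
        ≡⟨ cong (U +_) (∑-comm (λ i j → [ j ≺ i ] * f i j)) ⟩
      U + ∑[ j < n ] (∑[ i < n ] ([ j ≺ i ] * f i j))
        ≡⟨ cong (U +_) (sum-cong-≗ λ j → sum-cong-≗ λ i → cong ([ j ≺ i ] *_) (f-sym i j)) ⟩
      U + U
        ≡⟨ cong (U +_) (+-identityʳ U) ⟨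
      2 * U ∎
      where
      open ≡-Reasoning
      U = ∑[ i < n ] (∑[ j < n ] ([ i ≺ j ] * f i j))

sum-map-allFin : ∀ {n} (f : Fin n → ℕ) → List.sum (map f (allFin n)) ≡ ∑[ i < n ] f i
sum-map-allFin {n} f = trans (cong List.sum (map-tabulate id f)) (sum-tabulate f)
  where
  sum-tabulate : ∀ {n} (f : Fin n → ℕ) → List.sum (tabulate f) ≡ ∑[ i < n ] f i
  sum-tabulate {zero} f = refl
  sum-tabulate {suc n} f = cong (f zero +_) (sum-tabulate (f ∘ suc))

count≡∑ : ∀ {n} (p : Fin n → Bool) → count p ≡ ∑[ i < n ] 𝟙 (p i)
count≡∑ p = sum-map-allFin (𝟙 ∘ p)

count-as-∑ : ∀ {n} {p : Fin n → Bool} (f : Fin n → ℕ) →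
  (∀ i → 𝟙 (p i) ≡ f i) → count p ≡ ∑[ i < n ] f i
count-as-∑ {p = p} f 𝟙p≗f = trans (count≡∑ p) (sum-cong-≗ 𝟙p≗f)

count+count-not : ∀ {n} (p : Fin n → Bool) → count p + count (not ∘ p) ≡ n
count+count-not {n} p = begin
  count p + count (not ∘ p)                      ≡⟨ cong₂ _+_ (count≡∑ p) (count≡∑ (not ∘ p)) ⟩
  ∑[ i < n ] 𝟙 (p i) + ∑[ i < n ] 𝟙 (not (p i)) ≡⟨ ∑-distrib-+ (𝟙 ∘ p) (𝟙 ∘ not ∘ p) ⟨
  ∑[ i < n ] (𝟙 (p i) + 𝟙 (not (p i)))           ≡⟨ sum-cong-≗ (λ i → 𝟙+𝟙-not (p i)) ⟩
  ∑[ i < n ] 1                                   ≡⟨ ∑-const n 1 ⟩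
  n * 1                                          ≡⟨ *-identityʳ n ⟩
  n                                              ∎
  where
  open ≡-Reasoning
  𝟙+𝟙-not : ∀ b → 𝟙 b + 𝟙 (not b) ≡ 1
  𝟙+𝟙-not false = refl
  𝟙+𝟙-not true = refl

count-≤-agree-off : ∀ {n} (w : Fin n) (p q : Fin n → Bool) →
  (∀ j → j ≢ w → q j ≡ p j) → count p ≤ suc (count q)
count-≤-agree-off {n} w p q agree = begin
  count p                       ≡⟨ count≡∑ p ⟩
  ∑[ j < n ] 𝟙 (p j)            ≤⟨ ∑-mono-≤ pointwise ⟩
  ∑[ j < n ] (𝟙 (q j) + δ w j)  ≡⟨ ∑-+δ w (𝟙 ∘ q) ⟩
  suc (∑[ j < n ] 𝟙 (q j))      ≡⟨ cong suc (count≡∑ q) ⟨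
  suc (count q)                 ∎
  where
  open ≤-Reasoning
  pointwise : ∀ j → 𝟙 (p j) ≤ 𝟙 (q j) + δ w j
  pointwise j with j ≟ w
  ... | yes refl = ≤-trans (𝟙≤1 (p j)) (m≤n+m 1 (𝟙 (q j)))
  ... | no j≢w rewrite agree j j≢w = m≤m+n (𝟙 (p j)) 0

∃-of-count-pos : ∀ {n} (p : Fin n → Bool) → 0 < count p → ∃ λ u → p u ≡ true
∃-of-count-pos p pos = ∃-of-∑𝟙-pos p (subst (0 <_) (count≡∑ p) pos)
  where
  ∃-of-∑𝟙-pos : ∀ {n} (p : Fin n → Bool) → 0 < ∑[ i < n ] 𝟙 (p i) → ∃ λ u → p u ≡ true
  ∃-of-∑𝟙-pos {suc n} p pos with p zero in eq
  ... | true = zero , eq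
  ... | false = let (u , pu) = ∃-of-∑𝟙-pos (p ∘ suc) pos in suc u , pu

flipAt : ∀ {n} → Fin n → Partition n → Partition n
flipAt w P = updateAt P w not

module _ {n : ℕ} (G : SimpleGraph n) where

  crossAdj sameAdj : Partition n → Fin n → Fin n → ℕ
  crossAdj P i j = 𝟙 (adj G i j ∧ (P i xor P j))
  sameAdj P i j = 𝟙 (adj G i j ∧ not (P i xor P j))

  crossDeg sameDeg : Partition n → Fin n → ℕ
  crossDeg P v = ∑[ j < n ] crossAdj P v j
  sameDeg P v = ∑[ j < n ] sameAdj P v j

  crossDegSum : Partition n → ℕ
  crossDegSum P = ∑[ v < n ] crossDeg P v

  crossAdj-sym : ∀ P i j → crossAdj P i j ≡ crossAdj P j i
  crossAdj-sym P i j = cong₂ (λ a b → 𝟙 (a ∧ b)) (symmetric G i j) (xor-comm (P i) (P j))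

  sameAdj-sym : ∀ P i j → sameAdj P i j ≡ sameAdj P j i
  sameAdj-sym P i j = cong₂ (λ a b → 𝟙 (a ∧ not b)) (symmetric G i j) (xor-comm (P i) (P j))

  crossAdj-diag : ∀ P i → crossAdj P i i ≡ 0
  crossAdj-diag P i = cong (λ a → 𝟙 (a ∧ (P i xor P i))) (irreflexive G i)

  sameDeg+crossDeg≡degree : ∀ P v → sameDeg P v + crossDeg P v ≡ degree G v
  sameDeg+crossDeg≡degree P v = begin
    sameDeg P v + crossDeg P v                  ≡⟨ ∑-distrib-+ (sameAdj P v) (crossAdj P v) ⟨
    ∑[ u < n ] (sameAdj P v u + crossAdj P v u) ≡⟨ sum-cong-≗ (λ u → 𝟙-∧-split (adj G v u) (P v xor P u)) ⟩
    ∑[ u < n ] 𝟙 (adj G v u)                    ≡⟨ count≡∑ (adj G v) ⟨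
    degree G v                                  ∎
    where open ≡-Reasoning

  nbrsIn-other≡crossDeg : ∀ P v → nbrsIn G P (not (P v)) v ≡ crossDeg P v
  nbrsIn-other≡crossDeg P v =
    count-as-∑ (crossAdj P v) λ u → cong (λ b → 𝟙 (adj G v u ∧ b)) (if-not-xor (P v) (P u))
    where
    if-not-xor : ∀ x y → (if y then not x else not (not x)) ≡ x xor y
    if-not-xor true  true  = refl
    if-not-xor true  false = refl
    if-not-xor false true  = refl
    if-not-xor false false = refl

  nbrsIn-own≡sameDeg : ∀ P v → nbrsIn G P (P v) v ≡ sameDeg P v
  nbrsIn-own≡sameDeg P v =
    count-as-∑ (sameAdj P v) λ u → cong (λ b → 𝟙 (adj G v u ∧ b)) (if-xnor (P v) (P u))
    where
    if-xnor : ∀ x y → (if y then x else not x) ≡ not (x xor y)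
    if-xnor true  true  = refl
    if-xnor true  false = refl
    if-xnor false true  = refl
    if-xnor false false = refl

  degree<order : ∀ v → degree G v < n
  degree<order v = begin
    suc (degree G v)                    ≡⟨ cong suc (count≡∑ (adj G v)) ⟩
    suc (∑[ u < n ] 𝟙 (adj G v u))      ≡⟨ ∑-+δ v (𝟙 ∘ adj G v) ⟨
    ∑[ u < n ] (𝟙 (adj G v u) + δ v u)  ≤⟨ ∑-mono-≤ at-most-one ⟩
    ∑[ u < n ] 1                        ≡⟨ trans (∑-const n 1) (*-identityʳ n) ⟩
    n                                   ∎
    where
    open ≤-Reasoning
    at-most-one : ∀ u → 𝟙 (adj G v u) + δ v u ≤ 1
    at-most-one u with u ≟ v
    ... | yes refl rewrite irreflexive G u = ≤-refl
    ... | no _ = subst (_≤ 1) (sym (+-identityʳ _)) (𝟙≤1 (adj G v u))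

  cutSize≡∑∑ : ∀ P → cutSize G P ≡ ∑[ i < n ] (∑[ j < n ] ([ i ≺ j ] * crossAdj P i j))
  cutSize≡∑∑ P =
    trans (sum-map-allFin (λ i → count (λ j → (toℕ i <ᵇ toℕ j) ∧ adj G i j ∧ (P i xor P j))))
      (sum-cong-≗ λ i → count-as-∑ (λ j → [ i ≺ j ] * crossAdj P i j)
        λ j → 𝟙-∧ (toℕ i <ᵇ toℕ j) (adj G i j ∧ (P i xor P j)))

  cutSize-complement : ∀ P → cutSize G (not ∘ P) ≡ cutSize G P
  cutSize-complement P = begin
    cutSize G (not ∘ P)                                            ≡⟨ cutSize≡∑∑ (not ∘ P) ⟩
    ∑[ i < n ] (∑[ j < n ] ([ i ≺ j ] * crossAdj (not ∘ P) i j))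
      ≡⟨ sum-cong-≗ (λ i → sum-cong-≗ λ j → cong ([ i ≺ j ] *_) (complement-crossAdj i j)) ⟩
    ∑[ i < n ] (∑[ j < n ] ([ i ≺ j ] * crossAdj P i j))          ≡⟨ cutSize≡∑∑ P ⟨
    cutSize G P                                                    ∎
    where
    open ≡-Reasoning
    not-xor-not : ∀ x y → not x xor not y ≡ x xor y
    not-xor-not false y = not-involutive y
    not-xor-not true y = refl
    complement-crossAdj : ∀ i j → crossAdj (not ∘ P) i j ≡ crossAdj P i j
    complement-crossAdj i j = cong (λ b → 𝟙 (adj G i j ∧ b)) (not-xor-not (P i) (P j))

  crossDegSum≡2*cutSize : ∀ P → crossDegSum P ≡ 2 * cutSize G P
  crossDegSum≡2*cutSize P =
    trans (∑∑-symmetric (crossAdj P) (crossAdj-sym P) (crossAdj-diag P)) (cong (2 *_) (sym (cutSize≡∑∑ P)))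

  ∑-inside-crossDeg≡∑-outside : ∀ P →
    ∑[ v < n ] (𝟙 (P v) * crossDeg P v) ≡ ∑[ v < n ] (𝟙 (not (P v)) * crossDeg P v)
  ∑-inside-crossDeg≡∑-outside P = begin
    ∑[ v < n ] (𝟙 (P v) * crossDeg P v)
      ≡⟨ sum-cong-≗ (λ v → *-distribˡ-sum (𝟙 (P v)) (crossAdj P v)) ⟩
    ∑[ v < n ] (∑[ u < n ] (𝟙 (P v) * crossAdj P v u))
      ≡⟨ ∑-comm (λ v u → 𝟙 (P v) * crossAdj P v u) ⟩
    ∑[ u < n ] (∑[ v < n ] (𝟙 (P v) * crossAdj P v u))
      ≡⟨ sum-cong-≗ (λ u → sum-cong-≗ λ v → edge-from-inside u v) ⟩
    ∑[ u < n ] (∑[ v < n ] (𝟙 (not (P u)) * crossAdj P u v))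
      ≡⟨ sum-cong-≗ (λ u → *-distribˡ-sum (𝟙 (not (P u))) (crossAdj P u)) ⟨
    ∑[ u < n ] (𝟙 (not (P u)) * crossDeg P u) ∎
    where
    open ≡-Reasoning
    crossing : ∀ a x y → 𝟙 x * 𝟙 (a ∧ (y xor x)) ≡ 𝟙 (not y) * 𝟙 (a ∧ (y xor x))
    crossing false false false = refl
    crossing false false true = refl
    crossing false true false = refl
    crossing false true true = refl
    crossing true false false = refl
    crossing true false true = refl
    crossing true true false = refl
    crossing true true true = refl
    edge-from-inside : ∀ u v → 𝟙 (P v) * crossAdj P v u ≡ 𝟙 (not (P u)) * crossAdj P u v
    edge-from-inside u v = trans (cong (𝟙 (P v) *_) (crossAdj-sym P v u)) (crossing (adj G u v) (P v) (P u))

  cutSize≡∑-inside-crossDeg : ∀ P → cutSize G P ≡ ∑[ v < n ] (𝟙 (P v) * crossDeg P v)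
  cutSize≡∑-inside-crossDeg P = *-cancelˡ-≡ _ _ 2 (begin
    2 * cutSize G P  ≡⟨ crossDegSum≡2*cutSize P ⟨
    crossDegSum P    ≡⟨ sum-cong-≗ (λ v → 𝟙-partition (P v) (crossDeg P v)) ⟨
    ∑[ v < n ] (𝟙 (P v) * crossDeg P v + 𝟙 (not (P v)) * crossDeg P v)
                     ≡⟨ ∑-distrib-+ (λ v → 𝟙 (P v) * crossDeg P v) _ ⟩
    X + ∑[ v < n ] (𝟙 (not (P v)) * crossDeg P v)
                     ≡⟨ cong (X +_) (∑-inside-crossDeg≡∑-outside P) ⟨
    X + X            ≡⟨ cong (X +_) (+-identityʳ X) ⟨
    2 * X            ∎)
    where
    open ≡-Reasoning
    X = ∑[ v < n ] (𝟙 (P v) * crossDeg P v)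

  sameDeg<count : ∀ P v → P v ≡ true → sameDeg P v < count P
  sameDeg<count P v Pv = begin
    suc (sameDeg P v)                  ≡⟨ ∑-+δ v (sameAdj P v) ⟨
    ∑[ u < n ] (sameAdj P v u + δ v u) ≤⟨ ∑-mono-≤ same-side ⟩
    ∑[ u < n ] 𝟙 (P u)                 ≡⟨ count≡∑ P ⟨
    count P                            ∎
    where
    open ≤-Reasoning
    same-side : ∀ u → sameAdj P v u + δ v u ≤ 𝟙 (P u)
    same-side u with u ≟ v
    ... | yes refl rewrite irreflexive G u | Pv = ≤-refl
    ... | no _ rewrite Pv = inside (adj G v u) (P u)
      where
      inside : ∀ a y → 𝟙 (a ∧ not (true xor y)) + 0 ≤ 𝟙 y
      inside false false = z≤n
      inside false true = z≤n
      inside true false = z≤n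
      inside true true = ≤-refl

  count*[d+1]≤cutSize+count² : ∀ {d} → Regular d G → ∀ P → count P * (d + 1) ≤ cutSize G P + count P * count P
  count*[d+1]≤cutSize+count² {d} regular P = begin
    count P * (d + 1)                     ≡⟨ cong (_* (d + 1)) (count≡∑ P) ⟩
    (∑[ v < n ] 𝟙 (P v)) * (d + 1)        ≡⟨ *-distribʳ-sum (d + 1) (𝟙 ∘ P) ⟩
    ∑[ v < n ] (𝟙 (P v) * (d + 1))        ≤⟨ ∑-mono-≤ (λ v → 𝟙*-mono-≤ (P v) (inside-degree v)) ⟩
    ∑[ v < n ] (𝟙 (P v) * (crossDeg P v + count P))
      ≡⟨ sum-cong-≗ (λ v → *-distribˡ-+ (𝟙 (P v)) (crossDeg P v) (count P)) ⟩
    ∑[ v < n ] (𝟙 (P v) * crossDeg P v + 𝟙 (P v) * count P)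
      ≡⟨ ∑-distrib-+ (λ v → 𝟙 (P v) * crossDeg P v) (λ v → 𝟙 (P v) * count P) ⟩
    ∑[ v < n ] (𝟙 (P v) * crossDeg P v) + ∑[ v < n ] (𝟙 (P v) * count P)
      ≡⟨ cong₂ _+_ (cutSize≡∑-inside-crossDeg P) ∑-inside-count ⟨
    cutSize G P + count P * count P       ∎
    where
    open ≤-Reasoning
    ∑-inside-count : count P * count P ≡ ∑[ v < n ] (𝟙 (P v) * count P)
    ∑-inside-count = trans (cong (_* count P) (count≡∑ P)) (*-distribʳ-sum (count P) (𝟙 ∘ P))
    inside-degree : ∀ v → P v ≡ true → d + 1 ≤ crossDeg P v + count P
    inside-degree v Pv = begin
      d + 1                            ≡⟨ cong (_+ 1) (trans (sym (regular v)) (sym (sameDeg+crossDeg≡degree P v))) ⟩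
      sameDeg P v + crossDeg P v + 1   ≡⟨ +-comm (sameDeg P v + crossDeg P v) 1 ⟩
      suc (sameDeg P v + crossDeg P v) ≡⟨ cong suc (+-comm (sameDeg P v) (crossDeg P v)) ⟩
      suc (crossDeg P v + sameDeg P v) ≡⟨ +-suc (crossDeg P v) (sameDeg P v) ⟨
      crossDeg P v + suc (sameDeg P v) ≤⟨ +-monoʳ-≤ (crossDeg P v) (sameDeg<count P v Pv) ⟩
      crossDeg P v + count P           ∎

  crossAdj-flip : ∀ P w i j →
    crossAdj (flipAt w P) i j + (δ w i + δ w j) * crossAdj P i j ≡ crossAdj P i j + (δ w i + δ w j) * sameAdj P i j
  crossAdj-flip P w i j with i ≟ w | j ≟ w
  ... | yes refl | yes refl rewrite irreflexive G i = refl
  ... | yes refl | no j≢w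
    rewrite updateAt-updates i {not} P | updateAt-minimal j i {not} P j≢w | sym (not-distribˡ-xor (P i) (P j))
    = 𝟙-∧-exchange (adj G i j) (P i xor P j)
  ... | no i≢w | yes refl
    rewrite updateAt-updates j {not} P | updateAt-minimal i j {not} P i≢w | sym (not-distribʳ-xor (P i) (P j))
    = 𝟙-∧-exchange (adj G i j) (P i xor P j)
  ... | no i≢w | no j≢w rewrite updateAt-minimal i w {not} P i≢w | updateAt-minimal j w {not} P j≢w = refl

  crossDegSum-flip : ∀ P w →
    crossDegSum (flipAt w P) + (crossDeg P w + crossDeg P w) ≡ crossDegSum P + (sameDeg P w + sameDeg P w)
  crossDegSum-flip P w = begin
    crossDegSum P′ + (crossDeg P w + crossDeg P w)
      ≡⟨ cong (crossDegSum P′ +_) (∑∑-δ-pair (crossAdj P) (crossAdj-sym P) w) ⟨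
    crossDegSum P′ + ∑[ i < n ] (∑[ j < n ] ((δ w i + δ w j) * crossAdj P i j))
      ≡⟨ ∑∑-distrib-+ (crossAdj P′) (λ i j → (δ w i + δ w j) * crossAdj P i j) ⟨
    ∑[ i < n ] (∑[ j < n ] (crossAdj P′ i j + (δ w i + δ w j) * crossAdj P i j))
      ≡⟨ sum-cong-≗ (λ i → sum-cong-≗ (crossAdj-flip P w i)) ⟩
    ∑[ i < n ] (∑[ j < n ] (crossAdj P i j + (δ w i + δ w j) * sameAdj P i j))
      ≡⟨ ∑∑-distrib-+ (crossAdj P) (λ i j → (δ w i + δ w j) * sameAdj P i j) ⟩
    crossDegSum P + ∑[ i < n ] (∑[ j < n ] ((δ w i + δ w j) * sameAdj P i j))
      ≡⟨ cong (crossDegSum P +_) (∑∑-δ-pair (sameAdj P) (sameAdj-sym P) w) ⟩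
    crossDegSum P + (sameDeg P w + sameDeg P w) ∎
    where
    open ≡-Reasoning
    P′ = flipAt w P

  cutSize-flip : ∀ P w → cutSize G (flipAt w P) + crossDeg P w ≡ cutSize G P + sameDeg P w
  cutSize-flip P w = *-cancelˡ-≡ _ _ 2 (begin
    2 * (cutSize G P′ + c)     ≡⟨ twice-+ (cutSize G P′) c ⟩
    2 * cutSize G P′ + (c + c) ≡⟨ cong (_+ (c + c)) (crossDegSum≡2*cutSize P′) ⟨
    crossDegSum P′ + (c + c)   ≡⟨ crossDegSum-flip P w ⟩
    crossDegSum P + (s + s)    ≡⟨ cong (_+ (s + s)) (crossDegSum≡2*cutSize P) ⟩
    2 * cutSize G P + (s + s)  ≡⟨ twice-+ (cutSize G P) s ⟨
    2 * (cutSize G P + s)      ∎)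
    where
    open ≡-Reasoning
    P′ = flipAt w P
    c = crossDeg P w
    s = sameDeg P w
    twice-+ : ∀ x y → 2 * (x + y) ≡ 2 * x + (y + y)
    twice-+ = solve-∀

  cutSize-flip-≤ : ∀ P w {e} → sameDeg P w + e ≤ crossDeg P w → cutSize G (flipAt w P) + e ≤ cutSize G P
  cutSize-flip-≤ P w {e} gap = +-cancelʳ-≤ (sameDeg P w) _ _ (begin
    cutSize G P′ + e + sameDeg P w   ≡⟨ +-assoc (cutSize G P′) e (sameDeg P w) ⟩
    cutSize G P′ + (e + sameDeg P w) ≡⟨ cong (cutSize G P′ +_) (+-comm e (sameDeg P w)) ⟩
    cutSize G P′ + (sameDeg P w + e) ≤⟨ +-monoʳ-≤ (cutSize G P′) gap ⟩
    cutSize G P′ + crossDeg P w      ≡⟨ cutSize-flip P w ⟩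
    cutSize G P + sameDeg P w        ∎)
    where
    open ≤-Reasoning
    P′ = flipAt w P

  cutSize-flip-< : ∀ P w → sameDeg P w < crossDeg P w → cutSize G (flipAt w P) < cutSize G P
  cutSize-flip-< P w s<c =
    subst (_≤ cutSize G P) (+-comm _ 1) (cutSize-flip-≤ P w (subst (_≤ crossDeg P w) (+-comm 1 _) s<c))

  stable⇒internal : ∀ P → (∀ v → crossDeg P v ≤ sameDeg P v) → 0 < count P → 0 < count (not ∘ P) →
    IsInternalPartition G P
  stable⇒internal P stable inside outside =
    ∃-of-count-pos P inside ,
    (let (u , not-Pu) = ∃-of-count-pos (not ∘ P) outside in u , not-injective not-Pu) ,
    λ v → subst₂ _≤_ (sym (nbrsIn-other≡crossDeg P v)) (sym (nbrsIn-own≡sameDeg P v)) (stable v)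

SplitGap : ℕ → ℕ → Set
SplitGap d γ = ∀ a b → a + b ≡ d → a < b → a + γ ≤ b

splitGap-1 : ∀ d → SplitGap d 1
splitGap-1 d a b _ a<b = subst (_≤ b) (+-comm 1 a) a<b

splitGap-even : ∀ k → SplitGap (2 * k) 2
splitGap-even k a b a+b≡2k a<b with m≤n⇒m<n∨m≡n a<b
... | inj₁ a+1<b = subst (_≤ b) (+-comm 2 a) a+1<b
... | inj₂ refl = contradiction (trans (sym a+b≡2k) a+suc[a]≡odd) (even≢odd k a)
  where
  a+suc[a]≡odd : a + suc a ≡ suc (2 * a)
  a+suc[a]≡odd = trans (+-suc a a) (cong (λ x → suc (a + x)) (sym (+-identityʳ a)))

module Potential (d γ t m C : ℕ) (tight : C + γ * t + t * t < γ * m + t * (d + 1)) where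

  -- x + γ (m − a) ≤ C, stated without truncated subtraction, for a cut of size x and a class of size a.
  Admissible : ℕ → ℕ → Set
  Admissible x a = x + γ * m ≤ C + γ * a × t ≤ a

  admissible⇒t<size : ∀ {x a} → Admissible x a → a * (d + 1) ≤ x + a * a → t < a
  admissible⇒t<size {x} {a} (potential , t≤a) lower with m≤n⇒m<n∨m≡n t≤a
  ... | inj₁ t<a = t<a
  ... | inj₂ refl = contradiction tight (≤⇒≯ (begin
    γ * m + t * (d + 1) ≤⟨ +-monoʳ-≤ (γ * m) lower ⟩
    γ * m + (x + t * t) ≡⟨ +-assoc (γ * m) x (t * t) ⟨
    γ * m + x + t * t   ≡⟨ cong (_+ t * t) (+-comm (γ * m) x) ⟩
    x + γ * m + t * t   ≤⟨ +-monoˡ-≤ (t * t) potential ⟩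
    C + γ * t + t * t   ∎))
    where open ≤-Reasoning

  admissible-step : ∀ {x a x′ a′} →
    Admissible x a → t < a → x′ + γ ≤ x → a ≤ suc a′ → Admissible x′ a′
  admissible-step {x} {a} {x′} {a′} (potential , _) t<a drop shrink = +-cancelʳ-≤ γ _ _ (begin
    x′ + γ * m + γ      ≡⟨ +-assoc x′ (γ * m) γ ⟩
    x′ + (γ * m + γ)    ≡⟨ cong (x′ +_) (+-comm (γ * m) γ) ⟩
    x′ + (γ + γ * m)    ≡⟨ +-assoc x′ γ (γ * m) ⟨
    x′ + γ + γ * m      ≤⟨ +-monoˡ-≤ (γ * m) drop ⟩
    x + γ * m           ≤⟨ potential ⟩
    C + γ * a           ≤⟨ +-monoʳ-≤ C (*-monoʳ-≤ γ shrink) ⟩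
    C + γ * suc a′      ≡⟨ cong (C +_) (trans (*-suc γ a′) (+-comm γ (γ * a′))) ⟩
    C + (γ * a′ + γ)    ≡⟨ +-assoc C (γ * a′) γ ⟨
    C + γ * a′ + γ      ∎) , ≤-pred (≤-trans t<a shrink)
    where open ≤-Reasoning

module LocalSearch {n : ℕ} (G : SimpleGraph n) (d γ t m : ℕ) {C : ℕ}
  (regular : Regular d G) (gap : SplitGap d γ) (tight : C + γ * t + t * t < γ * m + t * (d + 1)) where

  open Potential d γ t m C tight

  Invariant : Partition n → Set
  Invariant P = Admissible (cutSize G P) (count P) × Admissible (cutSize G P) (count (not ∘ P))

  classes-large : ∀ P → Invariant P → t < count P × t < count (not ∘ P)
  classes-large P (inside , outside) =
    admissible⇒t<size inside (count*[d+1]≤cutSize+count² G regular P) ,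
    admissible⇒t<size outside
      (subst (λ x → count (not ∘ P) * (d + 1) ≤ x + count (not ∘ P) * count (not ∘ P))
        (cutSize-complement G P) (count*[d+1]≤cutSize+count² G regular (not ∘ P)))

  search : ∀ P → Acc _<_ (cutSize G P) → Invariant P → HasInternalPartition G
  search P (acc smaller) inv@(inside , outside)
    with classes-large P inv | all? (λ v → crossDeg G P v ≤? sameDeg G P v)
  ... | t<|A| , t<|B| | yes stable = P , stable⇒internal G P stable (m<n⇒0<n t<|A|) (m<n⇒0<n t<|B|)
  ... | t<|A| , t<|B| | no unstable with ¬∀⟶∃¬ n _ (λ v → crossDeg G P v ≤? sameDeg G P v) unstable
  ... | w , w-unstable = search P′ (smaller (cutSize-flip-< G P w (≰⇒> w-unstable)))
      ( admissible-step inside t<|A| drop (count-≤-agree-off w P P′ λ j j≢w → updateAt-minimal j w P j≢w)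
      , admissible-step outside t<|B| drop
          (count-≤-agree-off w (not ∘ P) (not ∘ P′) λ j j≢w → cong not (updateAt-minimal j w P j≢w)))
    where
    P′ = flipAt w P
    drop : cutSize G P′ + γ ≤ cutSize G P
    drop = cutSize-flip-≤ G P w (gap _ _ (trans (sameDeg+crossDeg≡degree G P w) (regular w)) (≰⇒> w-unstable))

  internal-of-bisection : n ≡ 2 * m → t ≤ m → HasBisectionOfSizeAtMost G C → HasInternalPartition G
  internal-of-bisection n≡2m t≤m (P , bisection , small) =
    search P (<-wellFounded (cutSize G P)) (admissible-at |A|≡m , admissible-at |B|≡m)
    where
    |A|≡m : count P ≡ m
    |A|≡m = *-cancelˡ-≡ _ _ 2 (trans bisection n≡2m)
    |B|≡m : count (not ∘ P) ≡ m
    |B|≡m = +-cancelˡ-≡ m _ _ (begin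
      m + count (not ∘ P)       ≡⟨ cong (_+ count (not ∘ P)) |A|≡m ⟨
      count P + count (not ∘ P) ≡⟨ count+count-not P ⟩
      n                         ≡⟨ n≡2m ⟩
      2 * m                     ≡⟨ cong (m +_) (+-identityʳ m) ⟩
      m + m                     ∎)
      where open ≡-Reasoning
    admissible-at : ∀ {a} → a ≡ m → Admissible (cutSize G P) a
    admissible-at refl = +-monoˡ-≤ (γ * m) small , t≤m

∸1-<-shift : ∀ x a b → 1 ≤ x → x ∸ 1 + a + b < x + a + b
∸1-<-shift (suc x) a b _ = ≤-refl

tight-odd : ∀ k m → 1 ≤ m →
  (m + k * (k + 1) ∸ 1) + 1 * (k + 1) + (k + 1) * (k + 1) < 1 * m + (k + 1) * (2 * k + 1 + 1)
tight-odd k m 1≤m = <-≤-trans (∸1-<-shift _ _ _ (≤-trans 1≤m (m≤m+n m _))) (≤-reflexive (identity m k))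
  where
  identity : ∀ m k → m + k * (k + 1) + 1 * (k + 1) + (k + 1) * (k + 1) ≡ 1 * m + (k + 1) * (2 * k + 1 + 1)
  identity = solve-∀

tight-even : ∀ k m → 1 ≤ k → 1 ≤ m →
  (2 * m + k * (k ∸ 1) ∸ 1) + 2 * k + k * k < 2 * m + k * (2 * k + 1)
tight-even (suc k) m _ 1≤m =
  <-≤-trans (∸1-<-shift (2 * m + suc k * k) _ _ (≤-trans 1≤m (≤-trans (m≤m+n m _) (m≤m+n (2 * m) _))))
    (≤-reflexive (identity m k))
  where
  identity : ∀ m k → 2 * m + suc k * k + 2 * suc k + suc k * suc k ≡ 2 * m + suc k * (2 * suc k + 1)
  identity = solve-∀

2k+1<2m⇒k+1≤m : ∀ {k m} → 2 * k + 1 < 2 * m → k + 1 ≤ m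
2k+1<2m⇒k+1≤m {k} {m} lt = *-cancelˡ-≤ 2 (subst (_≤ 2 * m) (sym (identity k)) lt)
  where
  identity : ∀ k → 2 * (k + 1) ≡ suc (2 * k + 1)
  identity = solve-∀

2k<2m⇒k≤m : ∀ {k m} → 2 * k < 2 * m → k ≤ m
2k<2m⇒k≤m lt = *-cancelˡ-≤ 2 (<⇒≤ lt)

regular⇒degree<order : ∀ {n d} (G : SimpleGraph n) → Regular d G → 1 ≤ n → d < n
regular⇒degree<order {suc n} G regular _ = subst (_< suc n) (regular zero) (degree<order G zero)

mainTheorem3 : (k m : ℕ) → 1 ≤ k → 1 ≤ m →
    ((G : SimpleGraph (2 * m)) → Regular (2 * k + 1) G →
      HasBisectionOfSizeAtMost G (m + k * (k + 1) ∸ 1) → HasInternalPartition G)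
    ×
    ((G : SimpleGraph (2 * m)) → Regular (2 * k) G →
      HasBisectionOfSizeAtMost G (2 * m + k * (k ∸ 1) ∸ 1) → HasInternalPartition G)
mainTheorem3 k m 1≤k 1≤m =
  (λ G regular → LocalSearch.internal-of-bisection G (2 * k + 1) 1 (k + 1) m
    regular (splitGap-1 _) (tight-odd k m 1≤m) refl (2k+1<2m⇒k+1≤m (regular⇒degree<order G regular 1≤2m))) ,
  (λ G regular → LocalSearch.internal-of-bisection G (2 * k) 2 k m
    regular (splitGap-even k) (tight-even k m 1≤k 1≤m) refl (2k<2m⇒k≤m (regular⇒degree<order G regular 1≤2m)))
  where
  1≤2m : 1 ≤ 2 * m
  1≤2m = ≤-trans 1≤m (m≤m+n m _)
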